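{- Let $N$ be a homogeneous network with asymmetric inputs. If $Q$ is a quotient network of $N$, then the fundamental network $\tilde{Q}$ of $Q$ is a quotient network of the fundamental network $\tilde{N}$ of $N$.
   Context: A homogeneous network with asymmetric inputs has a finite cell set $C$, one cell type, $k$ edge types, each cell receiving exactly one edge of each type; it is represented by $\sigma_1,\dots,\sigma_k:C\to C$ (type-$i$ edge into $c$ comes from $\sigma_i(c)$). A coloring (equivalence relation $\bowtie$ on cells) is balanced if cells of the same color have an edge-type-preserving bijection between their input sets that also preserves colors of source cells; for asymmetric inputs this means $c\bowtie d\Rightarrow\sigma_i(c)\bowtie\sigma_i(d)$ for all $i$. The quotient network w.r.t. $\bowtie$ has the classes as cells and, for each edge of type $i$ from a cell in class $[c]$ to $c'$, an edge of type $i$ from $[c]$ to $[c']$ (for asymmetric inputs: represented by $[c]\mapsto[\sigma_i(c)]$). $Q$ is a quotient network of $N$ if it is isomorphic to such a quotient; equivalently, there is a surjective network fibration $N\to Q$ (a map preserving sources, targets, cell and edge types and bijective on input sets; for asymmetric inputs, a cell map $\varphi$ with $\varphi\circ\sigma_i=\sigma^Q_i\circ\varphi$). Networks are identified up to isomorphism (bijective network fibration). The fundamental network $\tilde{N}$ has cells the semigroup $\tilde{C}$ of maps $C\to C$ generated by $Id_C,\sigma_1,\dots,\sigma_k$ under composition, represented by $\tilde{\sigma}_i(\gamma)=\sigma_i\circ\gamma$. -}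

module Defs where

open import Data.Nat using (ℕ)
open import Data.Fin using (Fin)
open import Data.Vec using (Vec; tabulate; lookup)
open import Data.Product using (Σ; ∃; _×_)
open import Relation.Binary.PropositionalEquality using (_≡_)
open import Function using (id)

-- A homogeneous network with asymmetric inputs and k edge types,
-- on an arbitrary carrier of cells: σ i c is the source of the
-- type-i edge into c.
record Net (k : ℕ) : Set₁ where
  field
    Cell : Set
    σ    : Fin k → Cell → Cell
open Net public

record FinNet (k n : ℕ) : Set where
  field
    σf : Fin k → Fin n → Fin n
open FinNet public

toNet : ∀ {k n} → FinNet k n → Net k
toNet {k} {n} N = record { Cell = Fin n ; σ = σf N }

IsFibration : ∀ {k} (N Q : Net k) → (Cell N → Cell Q) → Set
IsFibration N Q φ = ∀ i c → φ (σ N i c) ≡ σ Q i (φ c)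

Surjective : ∀ {A B : Set} → (A → B) → Set
Surjective {A} {B} f = ∀ (b : B) → ∃ λ (a : A) → f a ≡ b

IsQuotientOf : ∀ {k} (Q N : Net k) → Set
IsQuotientOf Q N = Σ (Cell N → Cell Q) λ φ → Surjective φ × IsFibration N Q φ

-- Maps C → C represented as vectors of images (so equality is extensional).
Map : ℕ → Set
Map n = Vec (Fin n) n

idMap : ∀ {n} → Map n
idMap = tabulate id

after : ∀ {k n} → FinNet k n → Fin k → Map n → Map n
after N i γ = tabulate (λ c → σf N i (lookup γ c))

data Generated {k n} (N : FinNet k n) : Map n → Set where
  gen-id   : Generated N idMap
  gen-step : ∀ {γ} (i : Fin k) → Generated N γ → Generated N (after N i γ)

-- Cells of the fundamental network: elements of the generated semigroup
-- (membership proof irrelevant, so cells are determined by the map).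
record FCell {k n} (N : FinNet k n) : Set where
  constructor fcell
  field
    fmap : Map n
    .gen : Generated N fmap
open FCell public

fσ : ∀ {k n} (N : FinNet k n) → Fin k → FCell N → FCell N
fσ N i (fcell γ g) = fcell (after N i γ) (gen-step i g)

Fundamental : ∀ {k n} → FinNet k n → Net k
Fundamental N = record { Cell = FCell N ; σ = fσ N }

-- A surjective fibration φ : N → Q pushes a map γ : C_N → C_N forward to
-- q ↦ φ (γ (s q)) for any section s of φ.  This sends Id to Id and
-- intertwines σᴺ i ∘ _ with σᴽ i ∘ _, so it restricts to a fibration
-- Ñ → Q̃, and it maps the word σ_{i_l} ∘ … ∘ σ_{i_1} of N to the same word
-- of Q, hence is onto.  Since membership in the semigroup is irrelevant
-- in a cell of Q̃, the word for a cell must be recomputed: by pigeonhole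
-- on the n ^ n maps, every element is reached by a word shorter than
-- n ^ n, and words of bounded length can be searched exhaustively.
module Submission where

open import Defs
open import Data.Nat using (ℕ; zero; suc; _^_; _≤_; _<_; s≤s; s≤s⁻¹; z<s; s<s)
open import Data.Nat.Properties using (≤-trans; ≤-reflexive; m∸n≤m; _<?_; ≮⇒≥)
open import Data.Nat.Induction using (<-wellFounded)
open import Induction.WellFounded using (Acc; acc)
open import Data.Fin using (Fin; toℕ; funToFin; finToFun)
open import Data.Fin.Properties using (any?; pigeonhole; toℕ<n; finToFun-funToFin)
  renaming (_≟_ to _≟ᶠ_)
open import Data.Vec using (tabulate; lookup)
open import Data.Vec.Properties using (≡-dec; tabulate-cong; tabulate∘lookup; lookup∘tabulate)
open import Data.List using (List; []; _∷_; _++_; [_]; length; take; drop)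
open import Data.List.Properties using (length-drop; take++drop≡id)
open import Data.Product using (∃; _×_; _,_; proj₁; proj₂)
open import Relation.Binary.PropositionalEquality
  using (_≡_; refl; sym; trans; cong; subst; module ≡-Reasoning)
open import Relation.Nullary using (Dec; yes; no)
open import Relation.Nullary.Decidable using (recompute)

length-take++drop< : ∀ {A : Set} {a b} (w : List A) → a < b → b ≤ length w →
  length (take a w ++ drop b w) < length w
length-take++drop< {a = zero} {suc b} (x ∷ w) _ _ =
  s≤s (≤-trans (≤-reflexive (length-drop b w)) (m∸n≤m (length w) b))
length-take++drop< {a = suc a} {suc b} (x ∷ w) (s<s a<b) (s≤s b≤∣w∣) =
  s<s (length-take++drop< w a<b b≤∣w∣)

module _ {n : ℕ} where

  _≟ᵐ_ : (γ δ : Map n) → Dec (γ ≡ δ)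
  _≟ᵐ_ = ≡-dec _≟ᶠ_

  code : Map n → Fin (n ^ n)
  code γ = funToFin (lookup γ)

  code-injective : ∀ {γ δ} → code γ ≡ code δ → γ ≡ δ
  code-injective {γ} {δ} eq = begin
    γ                         ≡⟨ sym (tabulate∘lookup γ) ⟩
    tabulate (lookup γ)       ≡⟨ tabulate-cong lookup-eq ⟩
    tabulate (lookup δ)       ≡⟨ tabulate∘lookup δ ⟩
    δ                         ∎
    where
    open ≡-Reasoning
    lookup-eq : ∀ c → lookup γ c ≡ lookup δ c
    lookup-eq c = trans (sym (finToFun-funToFin (lookup γ) c))
                        (trans (cong (λ x → finToFun x c) eq)
                               (finToFun-funToFin (lookup δ) c))

module _ {k n : ℕ} (N : FinNet k n) where

  -- The letters of a word are applied first to last: act [i₁,…,iₗ] γ = σ iₗ ∘ … ∘ σ i₁ ∘ γ.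
  act : List (Fin k) → Map n → Map n
  act []      γ = γ
  act (i ∷ w) γ = act w (after N i γ)

  act-++ : ∀ u v γ → act (u ++ v) γ ≡ act v (act u γ)
  act-++ []      v γ = refl
  act-++ (i ∷ u) v γ = act-++ u v (after N i γ)

  Generated-act : ∀ w {γ} → Generated N γ → Generated N (act w γ)
  Generated-act []      g = g
  Generated-act (i ∷ w) g = Generated-act w (gen-step i g)

  Generated⇒word : ∀ {γ} → Generated N γ → ∃ λ w → act w idMap ≡ γ
  Generated⇒word gen-id = [] , refl
  Generated⇒word (gen-step {γ} i g) with w , eq ← Generated⇒word g =
    w ++ [ i ] , trans (act-++ w [ i ] idMap) (cong (after N i) eq)

  Reaches : ℕ → Map n → Map n → Set
  Reaches b γ δ = ∃ λ w → length w < b × act w γ ≡ δ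

  reaches? : ∀ b γ δ → Dec (Reaches b γ δ)
  reaches? zero    γ δ = no λ ()
  reaches? (suc b) γ δ with γ ≟ᵐ δ
  ... | yes eq = yes ([] , z<s , eq)
  ... | no γ≢δ with any? (λ i → reaches? b (after N i γ) δ)
  ...   | yes (i , w , short , eq) = yes (i ∷ w , s<s short , eq)
  ...   | no ¬step = no λ where
           ([] , _ , eq)            → γ≢δ eq
           (i ∷ w , s<s short , eq) → ¬step (i , w , short , eq)

  -- Two prefixes of w with the same value exist by pigeonhole; cut out the segment between them.
  shorterWord : ∀ w → n ^ n ≤ length w →
    ∃ λ w′ → length w′ < length w × act w′ idMap ≡ act w idMap
  shorterWord w long
    with i , j , i<j , eq ← pigeonhole (s≤s long) (λ j → code (act (take (toℕ j) w) idMap)) =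
    take a w ++ drop b w , length-take++drop< w i<j (s≤s⁻¹ (toℕ<n j)) , same-value
    where
    open ≡-Reasoning
    a b : ℕ
    a = toℕ i
    b = toℕ j
    same-value : act (take a w ++ drop b w) idMap ≡ act w idMap
    same-value = begin
      act (take a w ++ drop b w) idMap        ≡⟨ act-++ (take a w) (drop b w) idMap ⟩
      act (drop b w) (act (take a w) idMap)   ≡⟨ cong (act (drop b w)) (code-injective eq) ⟩
      act (drop b w) (act (take b w) idMap)   ≡⟨ act-++ (take b w) (drop b w) idMap ⟨
      act (take b w ++ drop b w) idMap        ≡⟨ cong (λ u → act u idMap) (take++drop≡id b w) ⟩
      act w idMap                             ∎

  shortWord : ∀ w → Acc _<_ (length w) → Reaches (n ^ n) idMap (act w idMap)
  shortWord w (acc rec) with length w <? n ^ n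
  ... | yes short = w , short , refl
  ... | no ¬short with w′ , shorter , eq ← shorterWord w (≮⇒≥ ¬short)
                  with w″ , short , eq′ ← shortWord w′ (rec shorter) =
    w″ , short , trans eq′ eq

  Generated⇒Reaches : ∀ {γ} → Generated N γ → Reaches (n ^ n) idMap γ
  Generated⇒Reaches g with w , refl ← Generated⇒word g = shortWord w (<-wellFounded (length w))

  wordOf : ∀ {γ} → .(Generated N γ) → ∃ λ w → act w idMap ≡ γ
  wordOf {γ} g with w , _ , eq ← recompute (reaches? (n ^ n) idMap γ) (Generated⇒Reaches g) =
    w , eq

module Pushforward {k n m : ℕ} (N : FinNet k n) (Q : FinNet k m)
         (φ : Fin n → Fin m) (φ-surjective : Surjective φ)
         (φ-fibration : IsFibration (toNet N) (toNet Q) φ) where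

  private
    section : Fin m → Fin n
    section q = proj₁ (φ-surjective q)

  pushforward : Map n → Map m
  pushforward γ = tabulate (λ q → φ (lookup γ (section q)))

  pushforward-idMap : pushforward idMap ≡ idMap
  pushforward-idMap = tabulate-cong λ q →
    trans (cong φ (lookup∘tabulate (λ c → c) (section q))) (proj₂ (φ-surjective q))

  pushforward-after : ∀ i γ → pushforward (after N i γ) ≡ after Q i (pushforward γ)
  pushforward-after i γ = tabulate-cong λ q → begin
    φ (lookup (after N i γ) (section q))    ≡⟨ cong φ (lookup∘tabulate _ (section q)) ⟩
    φ (σf N i (lookup γ (section q)))       ≡⟨ φ-fibration i _ ⟩
    σf Q i (φ (lookup γ (section q)))       ≡⟨ cong (σf Q i) (lookup∘tabulate _ q) ⟨
    σf Q i (lookup (pushforward γ) q)       ∎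
    where open ≡-Reasoning

  pushforward-act : ∀ w γ → pushforward (act N w γ) ≡ act Q w (pushforward γ)
  pushforward-act []      γ = refl
  pushforward-act (i ∷ w) γ =
    trans (pushforward-act w (after N i γ)) (cong (act Q w) (pushforward-after i γ))

  Generated-pushforward : ∀ {γ} → Generated N γ → Generated Q (pushforward γ)
  Generated-pushforward gen-id =
    subst (Generated Q) (sym pushforward-idMap) gen-id
  Generated-pushforward (gen-step {γ} i g) =
    subst (Generated Q) (sym (pushforward-after i γ)) (gen-step i (Generated-pushforward g))

fcell-≡ : ∀ {k n} {N : FinNet k n} {γ δ : Map n} .{g : Generated N γ} .{h : Generated N δ} →
  γ ≡ δ → fcell {N = N} γ g ≡ fcell δ h
fcell-≡ refl = refl

mainTheorem3 : ∀ {k n m} (N : FinNet k n) (Q : FinNet k m)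
    → IsQuotientOf (toNet Q) (toNet N)
    → IsQuotientOf (Fundamental Q) (Fundamental N)
mainTheorem3 N Q (φ , φ-surjective , φ-fibration) = Φ , Φ-surjective , Φ-fibration
  where
  open Pushforward N Q φ φ-surjective φ-fibration

  Φ : FCell N → FCell Q
  Φ (fcell γ g) = fcell (pushforward γ) (Generated-pushforward g)

  Φ-fibration : IsFibration (Fundamental N) (Fundamental Q) Φ
  Φ-fibration i (fcell γ g) = fcell-≡ (pushforward-after i γ)

  Φ-surjective : Surjective Φ
  Φ-surjective (fcell δ h) with w , eq ← wordOf Q h =
    fcell (act N w idMap) (Generated-act N w gen-id) ,
    fcell-≡ (trans (pushforward-act w idMap)
                   (trans (cong (act Q w) pushforward-idMap) eq))
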